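{- Let $G$ be a finite directed multigraph without loops on vertex set $\{1,\dots,n+1\}$ having a global sink at vertex $n+1$, with reduced Laplacian $\Delta$. Let $\sigma\in\mathbb N^n$ be a $G$-positive script and let $\mathbf a,\mathbf b$ be stable configurations such that $\mathbf b=(\mathbf a+\sigma\Delta)^\circ$. Then $w(\mathbf b)\ge w(\mathbf a)$, where $w(\mathbf x)=\sum_{i=1}^n x_i$.
   Context: $G=(V,E)$ is a directed multigraph without loops, $V=\{1,\dots,n+1\}$; $d^+_i$ is the out-degree of $i$ and $e_{i,j}$ the number of edges from $i$ to $j$. Vertex $n+1$ is a global sink: it has no out-going edges and every other vertex has a directed path to it. The reduced Laplacian $\Delta\in\mathbb Z^{n\times n}$ has $\Delta_{ii}=d^+_i$ and $\Delta_{ij}=-e_{i,j}$ for $i\ne j$ ($i,j\le n$); $\Delta_i$ is its $i$-th row. Vectors are row vectors. A configuration is a vector in $\mathbb Z^n$. Vertex $i$ is active in $\mathbf a$ if $a_i\ge d^+_i$; firing it gives $\mathbf a-\Delta_i$. A firing sequence is legal if each fired vertex is active at the moment it fires. A stable configuration is a non-negative configuration with no active vertex. For non-negative $\mathbf a$, $\mathbf a^\circ$ denotes the unique stable configuration reachable from $\mathbf a$ by a legal firing sequence. Containment order: $a\succeq b$ iff $a_i\ge b_i$ for all $i$; $a\succ b$ means $a\succeq b$ and $a\neq b$. An $n$-script is a vector in $\mathbb N^n$; it is $G$-positive if $\sigma\Delta\succ\mathbf 0$. -}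

module Defs where

open import Data.Nat as ℕ using (ℕ; zero; suc)
open import Data.Integer as ℤ using (ℤ; +_; _+_; _-_; _*_; -_; _≤_; _<_)
open import Data.Fin using (Fin; zero; suc; inject₁; fromℕ; _≟_)
open import Data.Product using (_×_; Σ; ∃; _,_)
open import Data.Sum using (_⊎_)
open import Relation.Binary.PropositionalEquality using (_≡_; _≢_)
open import Relation.Nullary using (¬_; yes; no)

∑ℕ : ∀ {n} → (Fin n → ℕ) → ℕ
∑ℕ {zero}  f = 0
∑ℕ {suc n} f = f zero ℕ.+ ∑ℕ (λ i → f (suc i))

∑ : ∀ {n} → (Fin n → ℤ) → ℤ
∑ {zero}  f = + 0
∑ {suc n} f = f zero + ∑ (λ i → f (suc i))

-- A directed multigraph on n+1 vertices (Fin (suc n)); vertex n+1 of the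
-- paper is  fromℕ n  (the last element); vertices 1..n are  inject₁ i, i : Fin n.
-- edges i j = number of edges from i to j.
Multigraph : ℕ → Set
Multigraph n = Fin (suc n) → Fin (suc n) → ℕ

sink : (n : ℕ) → Fin (suc n)
sink n = fromℕ n

data Path {n : ℕ} (G : Multigraph n) : Fin (suc n) → Fin (suc n) → Set where
  here : ∀ {i} → Path G i i
  step : ∀ {i j k} → 0 ℕ.< G i j → Path G j k → Path G i k

record GlobalSinkGraph {n : ℕ} (G : Multigraph n) : Set where
  field
    noLoops   : ∀ i → G i i ≡ 0
    sinkNoOut : ∀ j → G (sink n) j ≡ 0
    toSink    : ∀ i → Path G i (sink n)

outdeg : ∀ {n} → Multigraph n → Fin (suc n) → ℕ
outdeg G i = ∑ℕ (G i)

Δ : ∀ {n} → Multigraph n → Fin n → Fin n → ℤ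
Δ G i j with i ≟ j
... | yes _ = + outdeg G (inject₁ i)
... | no  _ = - (+ G (inject₁ i) (inject₁ j))

Config : ℕ → Set
Config n = Fin n → ℤ

Script : ℕ → Set
Script n = Fin n → ℕ

_+ᶜ_ : ∀ {n} → Config n → Config n → Config n
(a +ᶜ b) i = a i + b i

_·Δ_ : ∀ {n} → Script n → Multigraph n → Config n
(σ ·Δ G) j = ∑ (λ i → + σ i * Δ G i j)

_⪰_ : ∀ {n} → Config n → Config n → Set
a ⪰ b = ∀ i → b i ≤ a i

_≻_ : ∀ {n} → Config n → Config n → Set
a ≻ b = a ⪰ b × ¬ (∀ i → a i ≡ b i)

𝟎 : ∀ {n} → Config n
𝟎 _ = + 0

GPositive : ∀ {n} → Multigraph n → Script n → Set
GPositive G σ = (σ ·Δ G) ≻ 𝟎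

Active : ∀ {n} → Multigraph n → Config n → Fin n → Set
Active G a i = + outdeg G (inject₁ i) ≤ a i

fire : ∀ {n} → Multigraph n → Config n → Fin n → Config n
fire G a i j = a j - Δ G i j

data LegalFiring {n : ℕ} (G : Multigraph n) : Config n → Config n → Set where
  done : ∀ {a} → LegalFiring G a a
  _∷_  : ∀ {a b} {i : Fin n} → Active G a i → LegalFiring G (fire G a i) b → LegalFiring G a b

NonNeg : ∀ {n} → Config n → Set
NonNeg a = ∀ i → + 0 ≤ a i

Stable : ∀ {n} → Multigraph n → Config n → Set
Stable G a = NonNeg a × (∀ i → ¬ Active G a i)

-- b = a° : b is the (unique) stable configuration reachable from a by a
-- legal firing sequence (a is assumed non-negative where this is used)
IsStabilization : ∀ {n} → Multigraph n → Config n → Config n → Set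
IsStabilization G a b = Stable G b × LegalFiring G a b

w : ∀ {n} → Config n → ℤ
w x = ∑ x

{-# OPTIONS --safe #-}
-- Along the firing sequence the configuration keeps the form a + ρΔ with ρ a script, starting
-- from ρ = σ: firing i subtracts the row Δᵢ, i.e. lowers ρ i by one. This never needs ρ i = 0,
-- since the off-diagonal entries of Δ are non-positive, so such an i holds at most aᵢ < d⁺ᵢ and
-- is not active. Hence b = a + τΔ for a script τ, and w b = w a + Σᵢ τᵢ w(Δᵢ) ≥ w a because every
-- row sum w(Δᵢ) = d⁺ᵢ − Σ_{j ≠ i, j ≤ n} e_{i,j} is non-negative.
module Submission where

open import Defs
open import Data.Nat as ℕ using (ℕ; zero; suc)
import Data.Nat.Properties as ℕ
open import Data.Integer using (ℤ; +≤+; +_; _+_; _-_; _*_; -_; 0ℤ; _≤_)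
open import Data.Integer.Properties
  using (+-*-semiring; ≤-refl; ≤-trans; ≤-reflexive; +-mono-≤; +-monoʳ-≤; +-identityʳ; i≤i+j;
         i≤j⇒0≤j-i; neg-distrib-+; neg-≤-pos; *-zeroˡ; *-zeroʳ; *-monoˡ-≤-nonNeg; module ≤-Reasoning)
open import Data.Fin using (Fin; zero; suc; inject₁; punchIn; _≟_)
open import Data.Fin.Properties using (punchInᵢ≢i)
open import Data.Vec.Functional using (updateAt; removeAt)
open import Data.Vec.Functional.Properties using (updateAt-updates; updateAt-minimal)
open import Data.Product using (Σ; _,_)
open import Function using (_∘_)
open import Relation.Binary.PropositionalEquality
open import Relation.Nullary using (¬_; Dec; yes; no; contradiction)
open import Data.Integer.Tactic.RingSolver using (solve-∀)
import Algebra.Properties.Semiring.Sum as SemiringSum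

module ℤΣ = SemiringSum +-*-semiring
module ℕΣ = SemiringSum ℕ.+-*-semiring

∑≡sum : ∀ {n} (f : Fin n → ℤ) → ∑ f ≡ ℤΣ.sum f
∑≡sum {zero}  f = refl
∑≡sum {suc n} f = cong (λ s → f zero + s) (∑≡sum (f ∘ suc))

∑ℕ≡sum : ∀ {n} (f : Fin n → ℕ) → ∑ℕ f ≡ ℕΣ.sum f
∑ℕ≡sum {zero}  f = refl
∑ℕ≡sum {suc n} f = cong (f zero ℕ.+_) (∑ℕ≡sum (f ∘ suc))

sum-neg-+ : ∀ {n} (f : Fin n → ℕ) → ℤΣ.sum (λ i → - + f i) ≡ - + ℕΣ.sum f
sum-neg-+ {zero}  f = refl
sum-neg-+ {suc n} f = begin
  - + f zero + ℤΣ.sum (λ i → - + f (suc i))  ≡⟨ cong (λ s → - + f zero + s) (sum-neg-+ (f ∘ suc)) ⟩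
  - + f zero + - + ℕΣ.sum (f ∘ suc)          ≡⟨ neg-distrib-+ (+ f zero) (+ ℕΣ.sum (f ∘ suc)) ⟨
  - + ℕΣ.sum f                               ∎
  where open ≡-Reasoning

sum-mono-≤ : ∀ {n} {f g : Fin n → ℤ} → (∀ i → f i ≤ g i) → ℤΣ.sum f ≤ ℤΣ.sum g
sum-mono-≤ {zero}  f≤g = ≤-refl
sum-mono-≤ {suc n} f≤g = +-mono-≤ (f≤g zero) (sum-mono-≤ (f≤g ∘ suc))

sum-nonneg : ∀ {n} {f : Fin n → ℤ} → (∀ i → 0ℤ ≤ f i) → 0ℤ ≤ ℤΣ.sum f
sum-nonneg {n} {f} 0≤f = subst (_≤ ℤΣ.sum f) (ℤΣ.sum-replicate-zero n) (sum-mono-≤ 0≤f)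

sum-nonpos : ∀ {n} {f : Fin n → ℤ} → (∀ i → f i ≤ 0ℤ) → ℤΣ.sum f ≤ 0ℤ
sum-nonpos {n} {f} f≤0 = subst (ℤΣ.sum f ≤_) (ℤΣ.sum-replicate-zero n) (sum-mono-≤ f≤0)

sum-agree-off : ∀ {n} {s t : Fin n → ℤ} (i : Fin n) → (∀ j → j ≢ i → s j ≡ t j) →
                ℤΣ.sum s - s i ≡ ℤΣ.sum t - t i
sum-agree-off {suc n} {s} {t} i s≡t = begin
  ℤΣ.sum s - s i                          ≡⟨ cong (_- s i) (ℤΣ.sum-remove s) ⟩
  s i + ℤΣ.sum (removeAt s i) - s i       ≡⟨ cong (λ r → s i + r - s i) (ℤΣ.sum-cong-≗ agree) ⟩
  s i + ℤΣ.sum (removeAt t i) - s i       ≡⟨ cancel (s i) (t i) _ ⟩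
  t i + ℤΣ.sum (removeAt t i) - t i       ≡⟨ cong (_- t i) (ℤΣ.sum-remove t) ⟨
  ℤΣ.sum t - t i                          ∎
  where
  open ≡-Reasoning
  agree : removeAt s i ≗ removeAt t i
  agree j = s≡t (punchIn i j) (punchInᵢ≢i i j)
  cancel : ∀ a b r → a + r - a ≡ b + r - b
  cancel = solve-∀

w-cong : ∀ {n} {x y : Config n} → x ≗ y → w x ≡ w y
w-cong {x = x} {y} x≗y = trans (∑≡sum x) (trans (ℤΣ.sum-cong-≗ x≗y) (sym (∑≡sum y)))

w-+ᶜ : ∀ {n} (x y : Config n) → w (x +ᶜ y) ≡ w x + w y
w-+ᶜ x y = begin
  w (x +ᶜ y)              ≡⟨ ∑≡sum (x +ᶜ y) ⟩
  ℤΣ.sum (x +ᶜ y)         ≡⟨ ℤΣ.∑-distrib-+ x y ⟩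
  ℤΣ.sum x + ℤΣ.sum y     ≡⟨ cong₂ _+_ (∑≡sum x) (∑≡sum y) ⟨
  w x + w y               ∎
  where open ≡-Reasoning

module _ {n : ℕ} (G : Multigraph n) where

  Δ-diag : ∀ i → Δ G i i ≡ + outdeg G (inject₁ i)
  Δ-diag i with i ≟ i
  ... | yes _  = refl
  ... | no i≢i = contradiction refl i≢i

  Δ-offdiag : ∀ {i j} → i ≢ j → Δ G i j ≡ - + G (inject₁ i) (inject₁ j)
  Δ-offdiag {i} {j} i≢j with i ≟ j
  ... | yes i≡j = contradiction i≡j i≢j
  ... | no _    = refl

  nonsink-outdeg-≤-outdeg : ∀ i → ℕΣ.sum (G i ∘ inject₁) ℕ.≤ outdeg G i
  nonsink-outdeg-≤-outdeg i = begin
    ℕΣ.sum (G i ∘ inject₁)                   ≤⟨ ℕ.m≤m+n _ _ ⟩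
    ℕΣ.sum (G i ∘ inject₁) ℕ.+ G i (sink n)  ≡⟨ ℕΣ.sum-init-last (G i) ⟨
    ℕΣ.sum (G i)                             ≡⟨ ∑ℕ≡sum (G i) ⟨
    outdeg G i                               ∎
    where open ℕ.≤-Reasoning

  Δ-rowSum-nonneg : ∀ i → 0ℤ ≤ ℤΣ.sum (Δ G i)
  Δ-rowSum-nonneg i = begin
    0ℤ                                   ≤⟨ i≤j⇒0≤j-i (+≤+ (nonsink-outdeg-≤-outdeg (inject₁ i))) ⟩
    + d - + ℕΣ.sum e                     ≤⟨ i≤i+j _ (+ e i) ⟩
    + d - + ℕΣ.sum e + + e i             ≡⟨ regroup (+ d) (+ ℕΣ.sum e) (+ e i) ⟩
    + d + (- + ℕΣ.sum e - - + e i)       ≡⟨ cong (λ s → + d + (s - - + e i)) (sum-neg-+ e) ⟨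
    + d + (ℤΣ.sum u - u i)               ≡⟨ cong (λ s → + d + s) (sum-agree-off i (λ j i≢j → Δ-offdiag (≢-sym i≢j))) ⟨
    + d + (ℤΣ.sum (Δ G i) - Δ G i i)     ≡⟨ cong (λ δ → + d + (ℤΣ.sum (Δ G i) - δ)) (Δ-diag i) ⟩
    + d + (ℤΣ.sum (Δ G i) - + d)         ≡⟨ cancel (+ d) (ℤΣ.sum (Δ G i)) ⟩
    ℤΣ.sum (Δ G i)                       ∎
    where
    open ≤-Reasoning
    d = outdeg G (inject₁ i)
    e = G (inject₁ i) ∘ inject₁
    u = λ j → - + e j
    regroup : ∀ a b c → a - b + c ≡ a + (- b - - c)
    regroup = solve-∀
    cancel : ∀ a s → a + (s - a) ≡ s
    cancel = solve-∀

  ·Δ≡sum : (ρ : Script n) (j : Fin n) → (ρ ·Δ G) j ≡ ℤΣ.sum (λ i → + ρ i * Δ G i j)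
  ·Δ≡sum ρ j = ∑≡sum (λ i → + ρ i * Δ G i j)

  w-·Δ-nonneg : (ρ : Script n) → 0ℤ ≤ w (ρ ·Δ G)
  w-·Δ-nonneg ρ = begin
    0ℤ                                                    ≤⟨ sum-nonneg (λ i → nonneg-* (ρ i) (Δ-rowSum-nonneg i)) ⟩
    ℤΣ.sum (λ i → + ρ i * ℤΣ.sum (Δ G i))                 ≡⟨ ℤΣ.sum-cong-≗ (λ i → ℤΣ.*-distribˡ-sum (+ ρ i) (Δ G i)) ⟩
    ℤΣ.sum (λ i → ℤΣ.sum (λ j → + ρ i * Δ G i j))         ≡⟨ ℤΣ.∑-comm (λ i j → + ρ i * Δ G i j) ⟩
    ℤΣ.sum (λ j → ℤΣ.sum (λ i → + ρ i * Δ G i j))         ≡⟨ ℤΣ.sum-cong-≗ (·Δ≡sum ρ) ⟨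
    ℤΣ.sum (ρ ·Δ G)                                       ≡⟨ ∑≡sum (ρ ·Δ G) ⟨
    w (ρ ·Δ G)                                            ∎
    where
    open ≤-Reasoning
    nonneg-* : ∀ k {x} → 0ℤ ≤ x → 0ℤ ≤ + k * x
    nonneg-* k 0≤x = subst (_≤ + k * _) (*-zeroʳ (+ k)) (*-monoˡ-≤-nonNeg (+ k) 0≤x)

  ·Δ-nonpos-at-unfired : (ρ : Script n) (j : Fin n) → ρ j ≡ 0 → (ρ ·Δ G) j ≤ 0ℤ
  ·Δ-nonpos-at-unfired ρ j ρj≡0 =
    subst (_≤ 0ℤ) (sym (·Δ≡sum ρ j)) (sum-nonpos (λ i → term-nonpos i (i ≟ j)))
    where
    term-nonpos : ∀ i → Dec (i ≡ j) → + ρ i * Δ G i j ≤ 0ℤ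
    term-nonpos i (yes refl) = ≤-reflexive (trans (cong (λ k → + k * Δ G i i) ρj≡0) (*-zeroˡ (Δ G i i)))
    term-nonpos i (no i≢j)   = subst (+ ρ i * Δ G i j ≤_) (*-zeroʳ (+ ρ i))
      (*-monoˡ-≤-nonNeg (+ ρ i) (subst (_≤ 0ℤ) (sym (Δ-offdiag i≢j)) neg-≤-pos))

  ·Δ-unfire : (ρ : Script n) (i : Fin n) {m : ℕ} → ρ i ≡ suc m →
              ρ ·Δ G ≗ (updateAt ρ i ℕ.pred ·Δ G) +ᶜ Δ G i
  ·Δ-unfire ρ i {m} ρi≡1+m j = begin
    (ρ ·Δ G) j                          ≡⟨ ·Δ≡sum ρ j ⟩
    ℤΣ.sum s                            ≡⟨ split (ℤΣ.sum s) (s i) ⟩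
    ℤΣ.sum s - s i + s i                ≡⟨ cong₂ _+_ (sum-agree-off i agree) pivot ⟩
    ℤΣ.sum t - t i + (t i + Δ G i j)    ≡⟨ merge (ℤΣ.sum t) (t i) (Δ G i j) ⟩
    ℤΣ.sum t + Δ G i j                  ≡⟨ cong (_+ Δ G i j) (·Δ≡sum ρ′ j) ⟨
    (ρ′ ·Δ G) j + Δ G i j               ∎
    where
    open ≡-Reasoning
    ρ′ = updateAt ρ i ℕ.pred
    s t : Fin n → ℤ
    s k = + ρ k * Δ G k j
    t k = + ρ′ k * Δ G k j
    agree : ∀ k → k ≢ i → s k ≡ t k
    agree k k≢i = cong (λ r → + r * Δ G k j) (sym (updateAt-minimal k i ρ k≢i))
    pivot : s i ≡ t i + Δ G i j
    pivot rewrite ρi≡1+m | updateAt-updates i {ℕ.pred} ρ | ρi≡1+m = succ-* (+ m) (Δ G i j)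
      where
      succ-* : ∀ a x → (+ 1 + a) * x ≡ a * x + x
      succ-* = solve-∀
    split : ∀ a b → a ≡ a - b + b
    split = solve-∀
    merge : ∀ a b c → a - b + (b + c) ≡ a + c
    merge = solve-∀

  least-action : ∀ {a x b} → (∀ i → ¬ Active G a i) → LegalFiring G x b →
                 (ρ : Script n) → x ≗ a +ᶜ (ρ ·Δ G) → Σ (Script n) λ τ → b ≗ a +ᶜ (τ ·Δ G)
  least-action a-quiet done ρ x≗a+ρΔ = ρ , x≗a+ρΔ
  least-action {a} {x} a-quiet (_∷_ {i = i} i-active rest) ρ x≗a+ρΔ with ρ i in ρi≡
  ... | zero  = contradiction (≤-trans i-active xi≤ai) (a-quiet i)
    where
    xi≤ai : x i ≤ a i
    xi≤ai = begin
      x i                 ≡⟨ x≗a+ρΔ i ⟩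
      a i + (ρ ·Δ G) i    ≤⟨ +-monoʳ-≤ (a i) (·Δ-nonpos-at-unfired ρ i ρi≡) ⟩
      a i + 0ℤ            ≡⟨ +-identityʳ (a i) ⟩
      a i                 ∎
      where open ≤-Reasoning
  ... | suc m = least-action a-quiet rest ρ′ fired≗a+ρ′Δ
    where
    ρ′ = updateAt ρ i ℕ.pred
    fired≗a+ρ′Δ : fire G x i ≗ a +ᶜ (ρ′ ·Δ G)
    fired≗a+ρ′Δ j = begin
      x j - Δ G i j                           ≡⟨ cong (_- Δ G i j) (x≗a+ρΔ j) ⟩
      a j + (ρ ·Δ G) j - Δ G i j              ≡⟨ cong (λ r → a j + r - Δ G i j) (·Δ-unfire ρ i ρi≡ j) ⟩
      a j + ((ρ′ ·Δ G) j + Δ G i j) - Δ G i j ≡⟨ cancel (a j) ((ρ′ ·Δ G) j) (Δ G i j) ⟩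
      a j + (ρ′ ·Δ G) j                       ∎
      where
      open ≡-Reasoning
      cancel : ∀ a r δ → a + (r + δ) - δ ≡ a + r
      cancel = solve-∀

lemma3 : (n : ℕ) (G : Multigraph n) → GlobalSinkGraph G →
         (σ : Script n) → GPositive G σ →
         (a b : Config n) → Stable G a → Stable G b →
         IsStabilization G (a +ᶜ (σ ·Δ G)) b →
         w a ≤ w b
lemma3 n G _ σ _ a b (_ , a-quiet) _ (_ , a+σΔ↝b)
  with least-action G a-quiet a+σΔ↝b σ (λ _ → refl)
... | τ , b≗a+τΔ = begin
  w a                    ≡⟨ +-identityʳ (w a) ⟨
  w a + 0ℤ               ≤⟨ +-monoʳ-≤ (w a) (w-·Δ-nonneg G τ) ⟩
  w a + w (τ ·Δ G)       ≡⟨ w-+ᶜ a (τ ·Δ G) ⟨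
  w (a +ᶜ (τ ·Δ G))      ≡⟨ w-cong (λ j → sym (b≗a+τΔ j)) ⟩
  w b                    ∎
  where open ≤-Reasoning
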